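{- Every simple game with five players which is proper or strong is roughly weighted.
   Context: A simple game is $(P,W)$ with $P$ a finite set of players, $W\subseteq 2^P$ (winning coalitions) closed under supersets within $P$, $W\ne\emptyset$, $W\ne 2^P$; other coalitions are losing. It is proper if $X\in W$ implies $P\setminus X\notin W$, and strong if $X\notin W$ implies $P\setminus X\in W$. It is roughly weighted if there exist non-negative reals $w_p$ ($p\in P$) and a real $q$, not all zero, such that $\sum_{p\in X}w_p<q$ implies $X$ losing and $\sum_{p\in X}w_p>q$ implies $X$ winning. -}

module Defs where

open import Data.Nat using (ℕ; suc)
open import Data.Bool using (Bool; true; false; if_then_else_)
open import Data.Fin using (Fin; zero; suc)
open import Data.Fin.Subset using (Subset; _⊆_; ∁)
open import Data.Vec using ([]; _∷_)
open import Data.Rational using (ℚ; 0ℚ; _+_; _≤_; _<_)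
open import Data.Product using (Σ; ∃; _×_)
open import Data.Sum using (_⊎_)
open import Relation.Binary.PropositionalEquality using (_≡_; _≢_)

record SimpleGame (n : ℕ) : Set where
  field
    win      : Subset n → Bool
    monotone : ∀ X Y → X ⊆ Y → win X ≡ true → win Y ≡ true
    someWin  : ∃ λ X → win X ≡ true
    someLose : ∃ λ X → win X ≡ false
open SimpleGame public

Proper : ∀ {n} → SimpleGame n → Set
Proper G = ∀ X → win G X ≡ true → win G (∁ X) ≡ false

Strong : ∀ {n} → SimpleGame n → Set
Strong G = ∀ X → win G X ≡ false → win G (∁ X) ≡ true

coalWeight : ∀ {n} → (Fin n → ℚ) → Subset n → ℚ
coalWeight w [] = 0ℚ
coalWeight w (b ∷ X) = (if b then w zero else 0ℚ) + coalWeight (λ i → w (suc i)) X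

RoughlyWeighted : ∀ {n} → SimpleGame n → Set
RoughlyWeighted {n} G =
  Σ (Fin n → ℚ) λ w → Σ ℚ λ q →
    (∀ p → 0ℚ ≤ w p)
    × ((∃ λ p → w p ≢ 0ℚ) ⊎ q ≢ 0ℚ)
    × (∀ X → coalWeight w X < q → win G X ≡ false)
    × (∀ X → q < coalWeight w X → win G X ≡ true)

-- Duality, X winning in G* iff ∁ X loses in G, preserves rough weightedness:
-- keep the weights and replace the quota q by (total weight) ∸ q. As the dual of a strong game
-- is proper, only proper games remain, and these are handled by an exhaustive search run by
-- the type checker: coalitions are declared winning or losing one at a time, branches that
-- contradict monotonicity or properness are pruned, and each surviving complete game is fitted
-- by one of sixteen fixed weightings.
module Submission where

open import Defs
open import Data.Bool using (Bool; true; false; not; _∧_; _∨_; T; if_then_else_)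
open import Data.Bool.Properties as Bool using (T-∧; T-≡; not-injective; not-involutive)
open import Data.Fin using (zero; suc)
open import Data.Fin.Subset using (Subset; _⊆_; ∁; ⊤; ⊥; ∣_∣)
open import Data.Fin.Subset.Properties using (_⊆?_; ⊆⊤; ⊥⊆; x∈∁p⇒x∉p; x∉p⇒x∈∁p)
open import Data.Bool.ListAction using (any)
open import Data.List using (List; []; _∷_; _++_; map; concatMap; filter)
open import Data.List.Relation.Unary.Any using (satisfied)
open import Data.List.Relation.Unary.Any.Properties using (any⁻)
open import Data.Maybe using (Maybe; just; nothing)
open import Data.Maybe.Properties using (just-injective)
open import Data.Nat as ℕ using (ℕ; zero; suc; _<ᵇ_; _∸_)
open import Data.Nat.Properties as ℕ
  using (<ᵇ⇒<; <⇒<ᵇ; ≮⇒≥; +-assoc; +-comm; m+[n∸m]≡n; m∸n+n≡m; +-monoˡ-<; +-cancelʳ-<)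
open import Data.Integer as ℤ using (+<+)
open import Data.Product using (_×_; _,_; proj₁; proj₂; ∃)
open import Data.Sum using (_⊎_; inj₁; inj₂)
open import Data.Rational as ℚ using (ℚ; 0ℚ; 1ℚ)
open import Data.Rational.Properties as ℚ using (+-0-monoid)
open import Data.Vec using (Vec; []; _∷_; lookup)
open import Data.Vec.Properties using (≡-dec)
open import Function using (_∘_; case_of_; Equivalence)
open import Relation.Binary.PropositionalEquality
open import Relation.Nullary using (yes; no; does; ¬_; contradiction)

open import Algebra.Properties.CommutativeSemigroup ℕ.+-commutativeSemigroup using (x∙yz≈y∙xz)
open import Algebra.Properties.Monoid.Mult +-0-monoid using (×-homo-+) renaming (_×_ to _·_)

private
  variable
    n : ℕ

fromℕ : ℕ → ℚ
fromℕ k = k · 1ℚ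

fromℕ-+ : ∀ a b → fromℕ (a ℕ.+ b) ≡ fromℕ a ℚ.+ fromℕ b
fromℕ-+ a b = ×-homo-+ 1ℚ a b

0ℚ<1ℚ : 0ℚ ℚ.< 1ℚ
0ℚ<1ℚ = ℚ.*<* (ℤ.+<+ ℕ.z<s)

fromℕ-nonNeg : ∀ k → 0ℚ ℚ.≤ fromℕ k
fromℕ-nonNeg zero    = ℚ.≤-refl
fromℕ-nonNeg (suc k) = ℚ.+-mono-≤ (ℚ.<⇒≤ 0ℚ<1ℚ) (fromℕ-nonNeg k)

fromℕ-positive : ∀ {k} → 0 ℕ.< k → 0ℚ ℚ.< fromℕ k
fromℕ-positive {suc k} _ = ℚ.+-mono-<-≤ 0ℚ<1ℚ (fromℕ-nonNeg k)

fromℕ-mono-≤ : ∀ {a b} → a ℕ.≤ b → fromℕ a ℚ.≤ fromℕ b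
fromℕ-mono-≤ {a} {b} a≤b = begin
  fromℕ a                     ≡⟨ ℚ.+-identityʳ (fromℕ a) ⟨
  fromℕ a ℚ.+ 0ℚ              ≤⟨ ℚ.+-monoʳ-≤ (fromℕ a) (fromℕ-nonNeg (b ∸ a)) ⟩
  fromℕ a ℚ.+ fromℕ (b ∸ a)   ≡⟨ fromℕ-+ a (b ∸ a) ⟨
  fromℕ (a ℕ.+ (b ∸ a))       ≡⟨ cong fromℕ (m+[n∸m]≡n a≤b) ⟩
  fromℕ b                     ∎
  where open ℚ.≤-Reasoning

fromℕ-cancel-< : ∀ {a b} → fromℕ a ℚ.< fromℕ b → a ℕ.< b
fromℕ-cancel-< {a} {b} lt with a ℕ.<? b
... | yes a<b = a<b
... | no  a≮b = contradiction (ℚ.<-≤-trans lt (fromℕ-mono-≤ (≮⇒≥ a≮b))) (ℚ.<-irrefl refl)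

natWeight : Vec ℕ n → Subset n → ℕ
natWeight []      []      = 0
natWeight (x ∷ w) (b ∷ X) = (if b then x else 0) ℕ.+ natWeight w X

coalWeight-fromℕ : ∀ (w : Vec ℕ n) X →
                   coalWeight (fromℕ ∘ lookup w) X ≡ fromℕ (natWeight w X)
coalWeight-fromℕ []      []          = refl
coalWeight-fromℕ (x ∷ w) (true ∷ X)  =
  trans (cong (fromℕ x ℚ.+_) (coalWeight-fromℕ w X)) (sym (fromℕ-+ x _))
coalWeight-fromℕ (x ∷ w) (false ∷ X) =
  trans (ℚ.+-identityˡ _) (coalWeight-fromℕ w X)

natWeight-∁ : ∀ (w : Vec ℕ n) X → natWeight w X ℕ.+ natWeight w (∁ X) ≡ natWeight w ⊤
natWeight-∁ []      []          = refl
natWeight-∁ (x ∷ w) (true ∷ X)  =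
  trans (+-assoc x (natWeight w X) _) (cong (x ℕ.+_) (natWeight-∁ w X))
natWeight-∁ (x ∷ w) (false ∷ X) =
  trans (x∙yz≈y∙xz (natWeight w X) x _) (cong (x ℕ.+_) (natWeight-∁ w X))

record NatRoughWeighting (G : SimpleGame n) : Set where
  field
    weights        : Vec ℕ n
    quota          : ℕ
    losing-below   : ∀ X → natWeight weights X ℕ.< quota → win G X ≡ false
    winning-above  : ∀ X → quota ℕ.< natWeight weights X → win G X ≡ true
    total-positive : 0 ℕ.< natWeight weights ⊤

positive-weight : ∀ (w : Vec ℕ n) X → 0 ℕ.< natWeight w X → ∃ λ p → 0 ℕ.< lookup w p
positive-weight []          []         ()
positive-weight (suc _ ∷ w) (true ∷ X) _ = zero , ℕ.z<s
positive-weight (zero ∷ w)  (true ∷ X) pos =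
  let (p , wp) = positive-weight w X pos in suc p , wp
positive-weight (_ ∷ w) (false ∷ X) pos =
  let (p , wp) = positive-weight w X pos in suc p , wp

natRoughWeighting⇒roughlyWeighted : {G : SimpleGame n} → NatRoughWeighting G → RoughlyWeighted G
natRoughWeighting⇒roughlyWeighted {G = G} W =
  fromℕ ∘ lookup weights , fromℕ quota ,
  (fromℕ-nonNeg ∘ lookup weights) ,
  inj₁ nonzero ,
  (λ X lt → losing-below X (fromℕ-cancel-< (subst (ℚ._< _) (coalWeight-fromℕ weights X) lt))) ,
  (λ X lt → winning-above X (fromℕ-cancel-< (subst (_ ℚ.<_) (coalWeight-fromℕ weights X) lt)))
  where
  open NatRoughWeighting W
  nonzero : ∃ λ p → fromℕ (lookup weights p) ≢ 0ℚ
  nonzero = let (p , pos) = positive-weight weights ⊤ total-positive in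
            p , λ eq → ℚ.<-irrefl (sym eq) (fromℕ-positive pos)

∁-involutive : (X : Subset n) → ∁ (∁ X) ≡ X
∁-involutive []      = refl
∁-involutive (b ∷ X) = cong₂ _∷_ (not-involutive b) (∁-involutive X)

∁-antitone : {X Y : Subset n} → X ⊆ Y → ∁ Y ⊆ ∁ X
∁-antitone X⊆Y x∈∁Y = x∉p⇒x∈∁p (x∈∁p⇒x∉p x∈∁Y ∘ X⊆Y)

module _ (G : SimpleGame n) where

  monotone-losing : ∀ X Y → X ⊆ Y → win G Y ≡ false → win G X ≡ false
  monotone-losing X Y X⊆Y Y-loses with win G X in X-wins
  ... | true  = trans (sym (monotone G X Y X⊆Y X-wins)) Y-loses
  ... | false = refl

  win-⊤ : win G ⊤ ≡ true
  win-⊤ = let (X , X-wins) = someWin G in monotone G X ⊤ ⊆⊤ X-wins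

  win-⊥ : win G ⊥ ≡ false
  win-⊥ = let (X , X-loses) = someLose G in monotone-losing ⊥ X ⊥⊆ X-loses

  quota≤total : (W : NatRoughWeighting G) →
                NatRoughWeighting.quota W ℕ.≤ natWeight (NatRoughWeighting.weights W) ⊤
  quota≤total W = ≮⇒≥ λ lt → case trans (sym win-⊤) (losing-below ⊤ lt) of λ ()
    where open NatRoughWeighting W

dual : SimpleGame n → SimpleGame n
dual G = record
  { win      = λ X → not (win G (∁ X))
  ; monotone = λ X Y X⊆Y → cong not ∘ monotone-losing G (∁ Y) (∁ X) (∁-antitone X⊆Y) ∘ not-injective
  ; someWin  = let (X , X-loses) = someLose G in
               ∁ X , cong not (trans (cong (win G) (∁-involutive X)) X-loses)
  ; someLose = let (X , X-wins) = someWin G in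
               ∁ X , cong not (trans (cong (win G) (∁-involutive X)) X-wins)
  }

strong⇒dual-proper : (G : SimpleGame n) → Strong G → Proper (dual G)
strong⇒dual-proper G strong X ∁X-loses = cong not (strong (∁ X) (not-injective ∁X-loses))

win-dual-∁ : (G : SimpleGame n) (X : Subset n) → win (dual G) (∁ X) ≡ not (win G X)
win-dual-∁ G X = cong (not ∘ win G) (∁-involutive X)

a+b≡c+d⇒a<d⇒c<b : ∀ {a b c d} → a ℕ.+ b ≡ c ℕ.+ d → a ℕ.< d → c ℕ.< b
a+b≡c+d⇒a<d⇒c<b {a} {b} {c} {d} eq a<d = +-cancelʳ-< d c b (begin-strict
  c ℕ.+ d ≡⟨ eq ⟨
  a ℕ.+ b <⟨ +-monoˡ-< b a<d ⟩
  d ℕ.+ b ≡⟨ +-comm d b ⟩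
  b ℕ.+ d ∎)
  where open ℕ.≤-Reasoning

-- With total weight t, X is below t ∸ q for G exactly when ∁ X is above q for the dual.
natRoughWeighting-fromDual : (G : SimpleGame n) → NatRoughWeighting (dual G) → NatRoughWeighting G
natRoughWeighting-fromDual G W = record
  { weights        = weights
  ; quota          = total ∸ quota
  ; losing-below   = λ X lt → not-injective (trans (sym (win-dual-∁ G X))
                       (winning-above (∁ X) (a+b≡c+d⇒a<d⇒c<b (split X) lt)))
  ; winning-above  = λ X lt → not-injective (trans (sym (win-dual-∁ G X))
                       (losing-below (∁ X) (a+b≡c+d⇒a<d⇒c<b (split-∸ X) lt)))
  ; total-positive = total-positive
  }
  where
  open NatRoughWeighting W
  total = natWeight weights ⊤
  split : ∀ X → natWeight weights X ℕ.+ natWeight weights (∁ X) ≡ quota ℕ.+ (total ∸ quota)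
  split X = trans (natWeight-∁ weights X) (sym (m+[n∸m]≡n (quota≤total (dual G) W)))
  split-∸ : ∀ X → (total ∸ quota) ℕ.+ quota ≡ natWeight weights (∁ X) ℕ.+ natWeight weights X
  split-∸ X = trans (m∸n+n≡m (quota≤total (dual G) W))
                   (trans (sym (natWeight-∁ weights X)) (+-comm (natWeight weights X) _))

allSubsets : (Subset n → Bool) → Bool
allSubsets {zero}  P = P []
allSubsets {suc n} P = allSubsets (P ∘ (true ∷_)) ∧ allSubsets (P ∘ (false ∷_))

allSubsets-sound : ∀ {P : Subset n → Bool} → T (allSubsets P) → ∀ X → T (P X)
allSubsets-sound h []          = h
allSubsets-sound h (true ∷ X)  = allSubsets-sound (proj₁ (Equivalence.to T-∧ h)) X
allSubsets-sound h (false ∷ X) = allSubsets-sound (proj₂ (Equivalence.to T-∧ h)) X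

allSubsets-complete : ∀ {P : Subset n → Bool} → (∀ X → T (P X)) → T (allSubsets P)
allSubsets-complete {zero}  h = h []
allSubsets-complete {suc n} h =
  Equivalence.from T-∧ (allSubsets-complete (h ∘ (true ∷_)) , allSubsets-complete (h ∘ (false ∷_)))

-- A binary trie indexed by coalitions, holding the value assigned to each so far.
PartialGame : ℕ → Set
PartialGame zero    = Maybe Bool
PartialGame (suc n) = PartialGame n × PartialGame n

unassigned : PartialGame n
unassigned {zero}  = nothing
unassigned {suc n} = unassigned , unassigned

valueAt : PartialGame n → Subset n → Maybe Bool
valueAt v       []          = v
valueAt (l , r) (true ∷ X)  = valueAt l X
valueAt (l , r) (false ∷ X) = valueAt r X

assign : Subset n → Bool → PartialGame n → PartialGame n
assign []          b _       = just b
assign (true ∷ Y)  b (l , r) = assign Y b l , r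
assign (false ∷ Y) b (l , r) = l , assign Y b r

valueAt-unassigned : (X : Subset n) → valueAt unassigned X ≡ nothing
valueAt-unassigned []          = refl
valueAt-unassigned (true ∷ X)  = valueAt-unassigned X
valueAt-unassigned (false ∷ X) = valueAt-unassigned X

valueAt-assign-≡ : ∀ (Y : Subset n) b v → valueAt (assign Y b v) Y ≡ just b
valueAt-assign-≡ []          b v       = refl
valueAt-assign-≡ (true ∷ Y)  b (l , r) = valueAt-assign-≡ Y b l
valueAt-assign-≡ (false ∷ Y) b (l , r) = valueAt-assign-≡ Y b r

valueAt-assign-≢ : ∀ {X Y : Subset n} b v → X ≢ Y → valueAt (assign Y b v) X ≡ valueAt v X
valueAt-assign-≢ {X = []}         {[]}        b v       X≢Y = contradiction refl X≢Y
valueAt-assign-≢ {X = true ∷ X}  {true ∷ Y}  b (l , r) X≢Y =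
  valueAt-assign-≢ b l (X≢Y ∘ cong (true ∷_))
valueAt-assign-≢ {X = false ∷ X} {false ∷ Y} b (l , r) X≢Y =
  valueAt-assign-≢ b r (X≢Y ∘ cong (false ∷_))
valueAt-assign-≢ {X = true ∷ X}  {false ∷ Y} b (l , r) _   = refl
valueAt-assign-≢ {X = false ∷ X} {true ∷ Y}  b (l , r) _   = refl

Agrees : PartialGame n → (Subset n → Bool) → Set
Agrees v f = ∀ X {b} → valueAt v X ≡ just b → f X ≡ b

agrees-unassigned : (f : Subset n → Bool) → Agrees unassigned f
agrees-unassigned f X v≡b = case trans (sym (valueAt-unassigned X)) v≡b of λ ()

agrees-assign : ∀ {v f} {Y : Subset n} {b} → Agrees v f → f Y ≡ b → Agrees (assign Y b v) f
agrees-assign {v = v} {Y = Y} {b} agrees fY≡b X v≡c with ≡-dec Bool._≟_ X Y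
... | yes refl = trans fY≡b (just-injective (trans (sym (valueAt-assign-≡ Y b v)) v≡c))
... | no  X≢Y  = agrees X (trans (sym (valueAt-assign-≢ b v X≢Y)) v≡c)

monotoneCompatible : Maybe Bool → Subset n → Subset n → Bool → Bool
monotoneCompatible (just true)  X Y false = not (does (X ⊆? Y))
monotoneCompatible (just false) X Y true  = not (does (Y ⊆? X))
monotoneCompatible _            _ _ _     = true

properCompatible : Maybe Bool → Bool → Bool
properCompatible (just true) true = false
properCompatible _           _    = true

admissible : PartialGame n → Subset n → Bool → Bool
admissible v Y b = properCompatible (valueAt v (∁ Y)) b
                 ∧ allSubsets (λ X → monotoneCompatible (valueAt v X) X Y b)

fitsValue : Maybe Bool → ℕ → ℕ → Bool
fitsValue (just true)  weight quota = not (weight <ᵇ quota)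
fitsValue (just false) weight quota = not (quota <ᵇ weight)
fitsValue nothing      _      _     = false

fits : PartialGame n → Vec ℕ n × ℕ → Bool
fits v (w , q) = (0 <ᵇ natWeight w ⊤) ∧ allSubsets (λ X → fitsValue (valueAt v X) (natWeight w X) q)

forBoth : (Bool → Bool) → Bool
forBoth P = P true ∧ P false

search : List (Vec ℕ n × ℕ) → List (Subset n) → PartialGame n → Bool
branch : List (Vec ℕ n × ℕ) → List (Subset n) → PartialGame n → Subset n → Bool → Bool

search ws []       v = any (fits v) ws
search ws (Y ∷ Ys) v = forBoth (branch ws Ys v Y)

branch ws Ys v Y b = not (admissible v Y b) ∨ search ws Ys (assign Y b v)

forBoth-sound : ∀ P → T (forBoth P) → ∀ b → T (P b)
forBoth-sound P h true  = proj₁ (Equivalence.to T-∧ h)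
forBoth-sound P h false = proj₂ (Equivalence.to T-∧ h)

T-not-∨-elim : ∀ {a b} → T (not a ∨ b) → T a → T b
T-not-∨-elim {true} h _ = h

T-not-<ᵇ : ∀ {a b} → T (not (a <ᵇ b)) → ¬ a ℕ.< b
T-not-<ᵇ {a} {b} h a<b with a <ᵇ b | <⇒<ᵇ a<b
... | true | _ = h

fitsValue-below : ∀ {m c q} → T (fitsValue m c q) → c ℕ.< q → m ≡ just false
fitsValue-below {just true}  h c<q = contradiction c<q (T-not-<ᵇ h)
fitsValue-below {just false} _ _   = refl

fitsValue-above : ∀ {m c q} → T (fitsValue m c q) → q ℕ.< c → m ≡ just true
fitsValue-above {just true}  _ _   = refl
fitsValue-above {just false} h q<c = contradiction q<c (T-not-<ᵇ h)

module _ {G : SimpleGame n} {v : PartialGame n} (agrees : Agrees v (win G)) where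

  monotoneCompatible-sound : ∀ X Y → T (monotoneCompatible (valueAt v X) X Y (win G Y))
  monotoneCompatible-sound X Y with valueAt v X in vX | win G Y in Y-wins
  ... | just true  | false with X ⊆? Y
  ...   | yes X⊆Y = case trans (sym (monotone G X Y X⊆Y (agrees X vX))) Y-wins of λ ()
  ...   | no  _   = _
  monotoneCompatible-sound X Y | just false | true with Y ⊆? X
  ...   | yes Y⊆X = case trans (sym (monotone G Y X Y⊆X Y-wins)) (agrees X vX) of λ ()
  ...   | no  _   = _
  monotoneCompatible-sound X Y | just true  | true  = _
  monotoneCompatible-sound X Y | just false | false = _
  monotoneCompatible-sound X Y | nothing    | _     = _

  properCompatible-sound : Proper G → ∀ Y → T (properCompatible (valueAt v (∁ Y)) (win G Y))
  properCompatible-sound proper Y with valueAt v (∁ Y) in v∁Y | win G Y in Y-wins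
  ... | just true  | true  = case trans (sym (agrees (∁ Y) v∁Y)) (proper Y Y-wins) of λ ()
  ... | just true  | false = _
  ... | just false | _     = _
  ... | nothing    | _     = _

  admissible-sound : Proper G → ∀ Y → T (admissible v Y (win G Y))
  admissible-sound proper Y = Equivalence.from T-∧
    (properCompatible-sound proper Y , allSubsets-complete λ X → monotoneCompatible-sound X Y)

  fits-sound : ∀ c → T (fits v c) → NatRoughWeighting G
  fits-sound (w , q) h = record
    { weights        = w
    ; quota          = q
    ; losing-below   = λ X lt → agrees X (fitsValue-below (fitsAll X) lt)
    ; winning-above  = λ X lt → agrees X (fitsValue-above (fitsAll X) lt)
    ; total-positive = <ᵇ⇒< 0 (natWeight w ⊤) positive
    }
    where
    positive = proj₁ (Equivalence.to T-∧ h)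
    fitsAll  = allSubsets-sound (proj₂ (Equivalence.to T-∧ h))

search-sound : ∀ {G : SimpleGame n} → Proper G → ∀ ws Ys v → Agrees v (win G) →
               search ws Ys v ≡ true → NatRoughWeighting G
search-sound proper ws [] v agrees h =
  let (c , fits-c) = satisfied (any⁻ (fits v) ws (Equivalence.from T-≡ h)) in
  fits-sound agrees c fits-c
search-sound {G = G} proper ws (Y ∷ Ys) v agrees h =
  search-sound proper ws Ys (assign Y (win G Y) v) (agrees-assign agrees refl)
               (Equivalence.to T-≡ next)
  where
  next : T (search ws Ys (assign Y (win G Y) v))
  next = T-not-∨-elim (forBoth-sound (branch ws Ys v Y) (Equivalence.from T-≡ h) (win G Y))
                      (admissible-sound {G = G} agrees proper Y)

seeded : PartialGame n
seeded = assign ⊤ true (assign ⊥ false unassigned)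

seeded-agrees : (G : SimpleGame n) → Agrees seeded (win G)
seeded-agrees G = agrees-assign (agrees-assign (agrees-unassigned (win G)) (win-⊥ G)) (win-⊤ G)

subsets : ∀ n → List (Subset n)
subsets zero    = [] ∷ []
subsets (suc n) = map (true ∷_) (subsets n) ++ map (false ∷_) (subsets n)

coalitionsBySize : ∀ n → List ℕ → List (Subset n)
coalitionsBySize n = concatMap λ k → filter (λ X → ∣ X ∣ ℕ.≟ k) (subsets n)

-- Found by an offline computer search.
properWeightings : List (Vec ℕ 5 × ℕ)
properWeightings =
  (1 ∷ 1 ∷ 1 ∷ 1 ∷ 1 ∷ [] , 3) ∷ (1 ∷ 0 ∷ 0 ∷ 1 ∷ 0 ∷ [] , 1) ∷ (0 ∷ 1 ∷ 0 ∷ 0 ∷ 1 ∷ [] , 1) ∷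
  (0 ∷ 0 ∷ 1 ∷ 0 ∷ 0 ∷ [] , 1) ∷ (1 ∷ 0 ∷ 0 ∷ 0 ∷ 0 ∷ [] , 1) ∷ (0 ∷ 1 ∷ 1 ∷ 0 ∷ 0 ∷ [] , 1) ∷
  (0 ∷ 0 ∷ 0 ∷ 1 ∷ 1 ∷ [] , 1) ∷ (0 ∷ 1 ∷ 0 ∷ 0 ∷ 0 ∷ [] , 1) ∷ (1 ∷ 0 ∷ 1 ∷ 0 ∷ 0 ∷ [] , 1) ∷
  (0 ∷ 0 ∷ 0 ∷ 1 ∷ 0 ∷ [] , 1) ∷ (1 ∷ 0 ∷ 0 ∷ 0 ∷ 1 ∷ [] , 1) ∷ (0 ∷ 1 ∷ 0 ∷ 1 ∷ 0 ∷ [] , 1) ∷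
  (0 ∷ 0 ∷ 1 ∷ 0 ∷ 1 ∷ [] , 1) ∷ (0 ∷ 0 ∷ 0 ∷ 0 ∷ 1 ∷ [] , 1) ∷ (1 ∷ 1 ∷ 0 ∷ 0 ∷ 0 ∷ [] , 1) ∷
  (0 ∷ 0 ∷ 1 ∷ 1 ∷ 0 ∷ [] , 1) ∷ []

-- Deciding small coalitions first lets monotonicity prune early.
coalitionOrder : List (Subset 5)
coalitionOrder = coalitionsBySize 5 (1 ∷ 2 ∷ 3 ∷ 4 ∷ [])

-- Stated with ≡ true rather than T: checking T (search …) makes Agda evaluate far more slowly.
search-succeeds : search properWeightings coalitionOrder seeded ≡ true
search-succeeds = refl

proper⇒natRoughWeighting : (G : SimpleGame 5) → Proper G → NatRoughWeighting G
proper⇒natRoughWeighting G proper =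
  search-sound proper properWeightings coalitionOrder seeded (seeded-agrees G) search-succeeds

theorem16 : (G : SimpleGame 5) → Proper G ⊎ Strong G → RoughlyWeighted G
theorem16 G (inj₁ proper) = natRoughWeighting⇒roughlyWeighted (proper⇒natRoughWeighting G proper)
theorem16 G (inj₂ strong) = natRoughWeighting⇒roughlyWeighted
  (natRoughWeighting-fromDual G (proper⇒natRoughWeighting (dual G) (strong⇒dual-proper G strong)))
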